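{- Let $q$ be an even power of an odd prime with $\sqrt{q} \equiv 1 \pmod 4$. If $a \in \mathbb{F}_q$ satisfies $a^{\sqrt{q}+1} = 1$, then $a^2+1$ is a square in $\mathbb{F}_q$, i.e. $a^2+1 \in \{x^2 : x \in \mathbb{F}_q\}$. -}

module Defs where

open import Level using (_⊔_)
open import Data.Nat using (ℕ; zero; suc)
open import Data.Product using (∃)
open import Data.Fin using (Fin)
open import Relation.Nullary using (¬_)
open import Relation.Binary.PropositionalEquality using () renaming (setoid to ≡-setoid)
open import Algebra.Bundles using (CommutativeRing)
open import Function.Bundles using (Inverse)

module _ {c ℓ} (R : CommutativeRing c ℓ) where
  open CommutativeRing R

  pow : Carrier → ℕ → Carrier
  pow x zero    = 1#
  pow x (suc n) = x * pow x n

  record IsField : Set (c ⊔ ℓ) where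
    field
      0≉1     : ¬ (0# ≈ 1#)
      inverse : ∀ x → ¬ (x ≈ 0#) → ∃ λ y → x * y ≈ 1#

  HasOrder : ℕ → Set (c ⊔ ℓ)
  HasOrder q = Inverse (≡-setoid (Fin q)) setoid

module Submission where

-- Let s = p ^ k, so that F has q = s ^ 2 elements, and let b = a ^ 2 + 1.  Translating all
-- elements by 1 shows q · 1 = 0, so F has characteristic p and x ↦ x ^ s is additive; hence
-- b ^ s · a ^ 2 = a ^ (2s + 2) + a ^ 2 = 1 + a ^ 2 = b.  For b ≠ 0 this gives b ^ (s - 1) · a ^ 2 = 1,
-- and raising to (s + 1) / 2 yields b ^ ((q - 1) / 2) = 1, because a ^ (s + 1) = 1.  Euler's criterion
-- then makes b a square: were it not, pairing each nonzero x with b / x would give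
-- ∏_{x ≠ 0} x = b ^ ((q - 1) / 2) = 1, while pairing x with x ⁻¹ gives ∏_{x ≠ 0} x = -1 (Wilson).

open import Level using (_⊔_)
open import Data.Nat as ℕ using (ℕ; zero; suc; _<_; z≤n; s≤s)
import Data.Nat.Properties as ℕ
open import Data.Nat.Combinatorics using (_C_; nC1≡n; nCn≡1; nCk+nC[k+1]≡[n+1]C[k+1])
open import Data.Nat.Divisibility using (_∣_; divides; ∣⇒≤)
open import Data.Nat.Primality using (Prime; euclidsLemma; ¬prime[0])
open import Data.Fin using (Fin; zero; suc; fromℕ; inject₁)
open import Data.Fin.Properties using (toℕ-fromℕ; toℕ-inject₁; toℕ<n)
open import Data.List using (List; []; _∷_; length; filter; foldr)
open import Data.Product using (∃; _,_; proj₁; proj₂) renaming (_×_ to _∧_)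
open import Data.Sum using (inj₁; inj₂)
open import Function using (_∘_)
open import Function.Bundles using (Inverse)
open import Relation.Nullary using (¬_; Dec; yes; no; contradiction)
open import Relation.Nullary.Decidable using (¬?)
open import Relation.Binary.Bundles using (DecSetoid)
open import Relation.Binary.Definitions using (Decidable)
open import Relation.Binary.PropositionalEquality as ≡ using (_≡_) renaming (setoid to ≡-setoid)
open import Algebra.Bundles using (CommutativeMonoid; AbelianGroup; CommutativeSemiring; CommutativeRing)
open import Defs

module _ where

  open import Data.Nat using (_+_; _*_; _^_; _%_; _/_)
  open import Data.Nat.Properties
  open import Data.Nat.Tactic.RingSolver using (solve-∀)
  open import Data.Nat.DivMod using (m≡m%n+[m/n]*n)
  open ≡.≡-Reasoning

  [k+1]*[n+1]C[k+1]≡[n+1]*nCk : ∀ n k → suc k * (suc n C suc k) ≡ suc n * (n C k)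
  [k+1]*[n+1]C[k+1]≡[n+1]*nCk zero    zero    = ≡.refl
  [k+1]*[n+1]C[k+1]≡[n+1]*nCk zero    (suc k) = *-zeroʳ (suc (suc k))
  [k+1]*[n+1]C[k+1]≡[n+1]*nCk (suc n) zero    =
    ≡.trans (+-identityʳ _) (≡.trans (nC1≡n (suc (suc n))) (≡.sym (*-identityʳ (suc (suc n)))))
  [k+1]*[n+1]C[k+1]≡[n+1]*nCk (suc n) (suc k) = begin
    suc (suc k) * (suc (suc n) C suc (suc k))   ≡⟨ ≡.cong (suc (suc k) *_) (nCk+nC[k+1]≡[n+1]C[k+1] (suc n) (suc k)) ⟨
    suc (suc k) * (A + B)                       ≡⟨ *-distribˡ-+ (suc (suc k)) A B ⟩
    (A + suc k * A) + suc (suc k) * B           ≡⟨ ≡.cong₂ (λ u v → (A + u) + v)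
                                                     ([k+1]*[n+1]C[k+1]≡[n+1]*nCk n k)
                                                     ([k+1]*[n+1]C[k+1]≡[n+1]*nCk n (suc k)) ⟩
    (A + suc n * (n C k)) + suc n * (n C suc k) ≡⟨ +-assoc A _ _ ⟩
    A + (suc n * (n C k) + suc n * (n C suc k)) ≡⟨ ≡.cong (A +_) (*-distribˡ-+ (suc n) (n C k) (n C suc k)) ⟨
    A + suc n * (n C k + n C suc k)             ≡⟨ ≡.cong (λ u → A + suc n * u) (nCk+nC[k+1]≡[n+1]C[k+1] n k) ⟩
    A + suc n * A                               ∎
    where
    A B : ℕ
    A = suc n C suc k
    B = suc n C suc (suc k)

  p∣pCk : ∀ {p k} → Prime p → 0 < k → k < p → p ∣ p C k
  p∣pCk {suc n} {suc k} p-prime _ k<p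
    with euclidsLemma (suc k) (suc n C suc k) p-prime
           (divides (n C k) (≡.trans ([k+1]*[n+1]C[k+1]≡[n+1]*nCk n k) (*-comm (suc n) (n C k))))
  ... | inj₁ p∣k+1 = contradiction (∣⇒≤ p∣k+1) (<⇒≱ k<p)
  ... | inj₂ p∣pCk = p∣pCk

  m+m≡n+n⇒m≡n : ∀ {m n} → m + m ≡ n + n → m ≡ n
  m+m≡n+n⇒m≡n {zero}  {zero}  _  = ≡.refl
  m+m≡n+n⇒m≡n {suc m} {suc n} eq = ≡.cong suc (m+m≡n+n⇒m≡n (suc-injective (begin
    suc (m + m) ≡⟨ +-suc m m ⟨
    m + suc m   ≡⟨ suc-injective eq ⟩
    n + suc n   ≡⟨ +-suc n n ⟩
    suc (n + n) ∎)))

  [1+2u]+1≡[1+u]+[1+u] : ∀ u → suc (u + u) + 1 ≡ suc u + suc u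
  [1+2u]+1≡[1+u]+[1+u] = solve-∀

  [1+2u]^2≡1+2[2u[1+u]] : ∀ u → suc (u + u) ^ 2 ≡ suc ((u + u) * suc u + (u + u) * suc u)
  [1+2u]^2≡1+2[2u[1+u]] = square
    where
    -- The ring solver does not read ℕ's _^_, so the square is spelled out as it unfolds.
    square : ∀ u → suc (u + u) * (suc (u + u) * 1) ≡ suc ((u + u) * suc u + (u + u) * suc u)
    square = solve-∀

  m%4≡1⇒m≡1+2[2[m/4]] : ∀ {m} → m % 4 ≡ 1 → m ≡ suc (m / 4 * 2 + m / 4 * 2)
  m%4≡1⇒m≡1+2[2[m/4]] {m} m%4≡1 = begin
    m                           ≡⟨ m≡m%n+[m/n]*n m 4 ⟩
    m % 4 + m / 4 * 4           ≡⟨ ≡.cong (_+ m / 4 * 4) m%4≡1 ⟩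
    1 + m / 4 * 4               ≡⟨ regroup (m / 4) ⟩
    suc (m / 4 * 2 + m / 4 * 2) ∎
    where
    regroup : ∀ d → 1 + d * 4 ≡ suc (d * 2 + d * 2)
    regroup = solve-∀

module Frobenius {a ℓ} (R : CommutativeSemiring a ℓ) where

  open CommutativeSemiring R hiding (zero)
  open import Relation.Binary.Reasoning.Setoid setoid
  open import Algebra.Properties.Semiring.Mult semiring using (_×_; ×-assoc-*; ×1-homo-*; ×-congˡ; ×-congʳ)
  open import Algebra.Properties.Semiring.Sum semiring using (sum; sum-init-last; sum-cong-≋; sum-replicate-zero)
  open import Algebra.Properties.CommutativeSemiring.Exp R using (_^_; ^-assocʳ; ^-congˡ)
  open import Algebra.Properties.CommutativeSemiring.Binomial R using (theorem; binomialTerm)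

  pCk×x≈0 : ∀ {p k} → Prime p → p × 1# ≈ 0# → ∀ x → 0 < k → k < p → (p C k) × x ≈ 0#
  pCk×x≈0 {p} {k} p-prime p×1≈0 x 0<k k<p with p∣pCk p-prime 0<k k<p
  ... | divides m pCk≡m*p = begin
    (p C k) × x                   ≈⟨ ×-congˡ pCk≡m*p ⟩
    (m ℕ.* p) × x                 ≈⟨ ×-congʳ (m ℕ.* p) (*-identityˡ x) ⟨
    (m ℕ.* p) × (1# * x)          ≈⟨ ×-assoc-* (m ℕ.* p) 1# x ⟨
    ((m ℕ.* p) × 1#) * x          ≈⟨ *-congʳ (×1-homo-* m p) ⟩
    ((m × 1#) * (p × 1#)) * x     ≈⟨ *-congʳ (*-congˡ p×1≈0) ⟩
    ((m × 1#) * 0#) * x           ≈⟨ *-congʳ (zeroʳ _) ⟩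
    0# * x                        ≈⟨ zeroˡ x ⟩
    0#                            ∎

  ^-distrib-+ : ∀ n → (∀ {k} x → 0 < k → k < suc n → (suc n C k) × x ≈ 0#) →
                ∀ x y → (x + y) ^ suc n ≈ x ^ suc n + y ^ suc n
  ^-distrib-+ n middle≈0 x y = begin
    (x + y) ^ suc n                                 ≈⟨ theorem (suc n) x y ⟩
    term zero + sum (term ∘ suc)                    ≈⟨ +-congˡ (sum-init-last (term ∘ suc)) ⟩
    term zero + (sum inner + term (suc (fromℕ n)))  ≈⟨ +-cong first (+-cong inner≈0 last) ⟩
    y ^ suc n + (0# + x ^ suc n)                    ≈⟨ +-comm _ _ ⟩
    (0# + x ^ suc n) + y ^ suc n                    ≈⟨ +-congʳ (+-identityˡ _) ⟩
    x ^ suc n + y ^ suc n                           ∎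
    where
    term : Fin (suc (suc n)) → Carrier
    term = binomialTerm x y (suc n)
    inner : Fin n → Carrier
    inner i = term (suc (inject₁ i))
    first : term zero ≈ y ^ suc n
    first = trans (+-identityʳ _) (*-identityˡ _)
    inner≈0 : sum inner ≈ 0#
    inner≈0 = trans (sum-cong-≋ (λ i → middle≈0 _ (s≤s z≤n)
                      (s≤s (≡.subst (ℕ._< n) (≡.sym (toℕ-inject₁ i)) (toℕ<n i)))))
                    (sum-replicate-zero n)
    last : term (suc (fromℕ n)) ≈ x ^ suc n
    last rewrite toℕ-fromℕ n | nCn≡1 (suc n) | ℕ.n∸n≡0 n = trans (+-identityʳ _) (*-identityʳ _)

  frobenius : ∀ {p} → Prime p → p × 1# ≈ 0# → ∀ x y → (x + y) ^ p ≈ x ^ p + y ^ p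
  frobenius {zero}  p-prime = contradiction p-prime ¬prime[0]
  frobenius {suc n} p-prime p×1≈0 = ^-distrib-+ n (pCk×x≈0 p-prime p×1≈0)

  frobenius-^ : ∀ {p} → Prime p → p × 1# ≈ 0# →
                ∀ j x y → (x + y) ^ (p ℕ.^ j) ≈ x ^ (p ℕ.^ j) + y ^ (p ℕ.^ j)
  frobenius-^ p-prime p×1≈0 zero x y = distribʳ 1# x y
  frobenius-^ {p} p-prime p×1≈0 (suc j) x y = begin
    (x + y) ^ (p ℕ.* p ℕ.^ j)                    ≈⟨ ^-assocʳ (x + y) p (p ℕ.^ j) ⟨
    ((x + y) ^ p) ^ p ℕ.^ j                      ≈⟨ ^-congˡ (p ℕ.^ j) (frobenius p-prime p×1≈0 x y) ⟩
    (x ^ p + y ^ p) ^ p ℕ.^ j                    ≈⟨ frobenius-^ p-prime p×1≈0 j (x ^ p) (y ^ p) ⟩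
    (x ^ p) ^ p ℕ.^ j + (y ^ p) ^ p ℕ.^ j        ≈⟨ +-cong (^-assocʳ x p (p ℕ.^ j)) (^-assocʳ y p (p ℕ.^ j)) ⟩
    x ^ (p ℕ.* p ℕ.^ j) + y ^ (p ℕ.* p ℕ.^ j)    ∎

module _ {c ℓ} (G : AbelianGroup c ℓ) where

  open AbelianGroup G
  open import Relation.Binary.Reasoning.Setoid setoid
  open import Algebra.Properties.AbelianGroup G using (identityʳ-unique; //-rightDividesˡ; //-rightDividesʳ)
  open import Algebra.Properties.CommutativeMonoid.Sum commutativeMonoid
    using (sum; sum-permute; ∑-distrib-+; sum-replicate; sum-cong-≋)
  open import Algebra.Properties.Monoid.Mult monoid using (_×_)
  open import Data.Fin.Permutation using (Permutation; permutation)
  open import Data.Vec.Functional using (replicate)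

  card×x≈ε : ∀ {q} → Inverse (≡-setoid (Fin q)) setoid → ∀ g → q × g ≈ ε
  card×x≈ε {q} enumeration g = identityʳ-unique (sum to) (q × g) (begin
    sum to ∙ q × g                    ≈⟨ ∙-congˡ (sum-replicate q) ⟨
    sum to ∙ sum (replicate q g)      ≈⟨ ∑-distrib-+ to (replicate q g) ⟨
    sum (λ i → to i ∙ g)              ≈⟨ sum-cong-≋ (λ i → strictlyInverseˡ (to i ∙ g)) ⟨
    sum (λ i → to (from (to i ∙ g)))  ≈⟨ sum-permute to translation ⟨
    sum to                            ∎)
    where
    open Inverse enumeration
    translation : Permutation q q
    translation = permutation (λ i → from (to i ∙ g)) (λ i → from (to i ∙ g ⁻¹))
      (λ i → ≡.trans (from-cong (trans (∙-congʳ (strictlyInverseˡ _)) (//-rightDividesˡ g (to i))))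
                     (strictlyInverseʳ i))
      (λ i → ≡.trans (from-cong (trans (∙-congʳ (strictlyInverseˡ _)) (//-rightDividesʳ g (to i))))
                     (strictlyInverseʳ i))

module Removal {c ℓ} (S : DecSetoid c ℓ) where

  open DecSetoid S
  open import Data.List.Membership.Setoid setoid using (_∈_; _∉_)
  open import Data.List.Membership.Setoid.Properties using (∈-filter⁺; ∈-filter⁻; ∈-resp-≈)
  open import Data.List.Relation.Unary.Unique.Setoid setoid using (Unique)
  open import Data.List.Relation.Unary.Unique.Setoid.Properties using (filter⁺; Unique[x∷xs]⇒x∉xs)
  open import Data.List.Relation.Unary.AllPairs using (_∷_)
  open import Data.List.Relation.Unary.Any using (here; there)
  open import Data.List.Relation.Unary.All.Properties using (¬Any⇒All¬)
  open import Data.List.Properties using (filter-all)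

  remove : Carrier → List Carrier → List Carrier
  remove x = filter (¬? ∘ (x ≟_))

  private
    ≉-respʳ : ∀ {x y z} → y ≈ z → ¬ x ≈ y → ¬ x ≈ z
    ≉-respʳ y≈z x≉y x≈z = x≉y (trans x≈z (sym y≈z))

  ∈-remove⁺ : ∀ {x y xs} → y ∈ xs → ¬ x ≈ y → y ∈ remove x xs
  ∈-remove⁺ {x} = ∈-filter⁺ setoid (¬? ∘ (x ≟_)) ≉-respʳ

  ∈-remove⁻ : ∀ {x y} xs → y ∈ remove x xs → y ∈ xs ∧ ¬ x ≈ y
  ∈-remove⁻ {x} _ = ∈-filter⁻ setoid (¬? ∘ (x ≟_)) ≉-respʳ

  remove-unique : ∀ {x xs} → Unique xs → Unique (remove x xs)
  remove-unique {x} = filter⁺ setoid (¬? ∘ (x ≟_))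

  remove-∉ : ∀ {x xs} → x ∉ xs → remove x xs ≡ xs
  remove-∉ {x} {xs} x∉xs = filter-all (¬? ∘ (x ≟_)) (¬Any⇒All¬ xs x∉xs)

  remove-head : ∀ {x y xs} → Unique (y ∷ xs) → x ≈ y → remove x xs ≡ xs
  remove-head y∷xs-unique x≈y = remove-∉ (Unique[x∷xs]⇒x∉xs setoid y∷xs-unique ∘ ∈-resp-≈ setoid x≈y)

  length-remove : ∀ {x xs} → Unique xs → x ∈ xs → suc (length (remove x xs)) ≡ length xs
  length-remove {x} {y ∷ xs} y∷xs-unique@(_ ∷ xs-unique) x∈y∷xs with x ≟ y | x∈y∷xs
  ... | yes x≈y | _ = ≡.cong (suc ∘ length) (remove-head y∷xs-unique x≈y)
  ... | no x≉y | here x≈y = contradiction x≈y x≉y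
  ... | no x≉y | there x∈xs = ≡.cong suc (length-remove xs-unique x∈xs)

module ListProduct {c ℓ} (M : CommutativeMonoid c ℓ) (_≟_ : Decidable (CommutativeMonoid._≈_ M)) where

  open CommutativeMonoid M
  open import Relation.Binary.Reasoning.Setoid setoid
  open import Algebra.Properties.Monoid.Mult monoid using (_×_)
  open import Data.List.Membership.Setoid setoid using (_∈_)
  open import Data.List.Relation.Unary.Unique.Setoid setoid using (Unique)
  open import Data.List.Relation.Unary.Any using (here; there)
  open import Data.List.Relation.Unary.AllPairs using (_∷_)
  open import Algebra.Properties.CommutativeSemigroup commutativeSemigroup using (x∙yz≈y∙xz)

  decSetoid : DecSetoid c ℓ
  decSetoid = record { isDecEquivalence = record { isEquivalence = isEquivalence ; _≟_ = _≟_ } }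

  open Removal decSetoid public

  product : List Carrier → Carrier
  product = foldr _∙_ ε

  product-remove : ∀ {x xs} → Unique xs → x ∈ xs → product xs ≈ x ∙ product (remove x xs)
  product-remove {x} {y ∷ xs} y∷xs-unique@(_ ∷ xs-unique) x∈y∷xs with x ≟ y | x∈y∷xs
  ... | yes x≈y | _ = ∙-cong (sym x≈y) (reflexive (≡.cong product (≡.sym (remove-head y∷xs-unique x≈y))))
  ... | no x≉y | here x≈y = contradiction x≈y x≉y
  ... | no x≉y | there x∈xs = begin
    y ∙ product xs                       ≈⟨ ∙-congˡ (product-remove xs-unique x∈xs) ⟩
    y ∙ (x ∙ product (remove x xs))      ≈⟨ x∙yz≈y∙xz y x _ ⟩
    x ∙ (y ∙ product (remove x xs))      ∎

  module Involution (σ : Carrier → Carrier) (σ-cong : ∀ {x y} → x ≈ y → σ x ≈ σ y)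
                    (σ-involutive : ∀ x → σ (σ x) ≈ x) where

    σ-flip : ∀ {x y} → x ≈ σ y → σ x ≈ y
    σ-flip x≈σy = trans (σ-cong x≈σy) (σ-involutive _)

    Closed : List Carrier → Set (c ⊔ ℓ)
    Closed xs = ∀ {x} → x ∈ xs → σ x ∈ xs

    remove-fixed-closed : ∀ {z xs} → σ z ≈ z → Closed xs → Closed (remove z xs)
    remove-fixed-closed {xs = xs} σz≈z closed y∈ with ∈-remove⁻ xs y∈
    ... | y∈xs , z≉y = ∈-remove⁺ (closed y∈xs) (λ z≈σy → z≉y (trans (sym σz≈z) (σ-flip z≈σy)))

    remove-pair-closed : ∀ {x xs} → Closed xs → Closed (remove (σ x) (remove x xs))
    remove-pair-closed {x} {xs} closed y∈ with ∈-remove⁻ (remove x xs) y∈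
    ... | y∈' , σx≉y with ∈-remove⁻ xs y∈'
    ...   | y∈xs , x≉y = ∈-remove⁺ (∈-remove⁺ (closed y∈xs) (λ x≈σy → σx≉y (σ-flip x≈σy)))
                                   (λ σx≈σy → x≉y (trans (sym (σ-involutive _)) (σ-flip σx≈σy)))

    record Paired (k : Carrier) (xs : List Carrier) : Set (c ⊔ ℓ) where
      field
        unique       : Unique xs
        closed       : Closed xs
        fixpointFree : ∀ {x} → x ∈ xs → ¬ σ x ≈ x
        pairsTo      : ∀ {x} → x ∈ xs → x ∙ σ x ≈ k

    module _ {k xs x} (paired : Paired k xs) (x∈xs : x ∈ xs) where

      open Paired paired

      private
        σx∈remove-x : σ x ∈ remove x xs
        σx∈remove-x = ∈-remove⁺ (closed x∈xs) (λ x≈σx → fixpointFree x∈xs (sym x≈σx))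

      remove-pair : Paired k (remove (σ x) (remove x xs))
      remove-pair = record
        { unique       = remove-unique (remove-unique unique)
        ; closed       = remove-pair-closed closed
        ; fixpointFree = fixpointFree ∘ inner
        ; pairsTo      = pairsTo ∘ inner
        }
        where
        inner : ∀ {y} → y ∈ remove (σ x) (remove x xs) → y ∈ xs
        inner = proj₁ ∘ ∈-remove⁻ xs ∘ proj₁ ∘ ∈-remove⁻ (remove x xs)

      length-remove-pair : length xs ≡ suc (suc (length (remove (σ x) (remove x xs))))
      length-remove-pair = ≡.sym (≡.trans (≡.cong suc (length-remove (remove-unique unique) σx∈remove-x))
                                         (length-remove unique x∈xs))

      product-remove-pair : product xs ≈ k ∙ product (remove (σ x) (remove x xs))
      product-remove-pair = begin
        product xs                                        ≈⟨ product-remove unique x∈xs ⟩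
        x ∙ product (remove x xs)                         ≈⟨ ∙-congˡ (product-remove (remove-unique unique) σx∈remove-x) ⟩
        x ∙ (σ x ∙ product (remove (σ x) (remove x xs)))  ≈⟨ assoc _ _ _ ⟨
        (x ∙ σ x) ∙ product (remove (σ x) (remove x xs))  ≈⟨ ∙-congʳ (pairsTo x∈xs) ⟩
        k ∙ product (remove (σ x) (remove x xs))          ∎

    product-paired : ∀ {k xs} → Paired k xs → ∃ λ n → length xs ≡ n ℕ.+ n ∧ product xs ≈ n × k
    product-paired {xs = xs} = go (length xs) ≡.refl
      where
      go : ∀ m {k xs} → length xs ≡ m → Paired k xs → ∃ λ n → m ≡ n ℕ.+ n ∧ product xs ≈ n × k
      go zero {xs = []} _ _ = 0 , ≡.refl , refl
      go (suc m) {xs = x ∷ xs} len≡1+m paired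
        with ≡.trans (≡.sym len≡1+m) (length-remove-pair paired (here refl))
      go (suc zero)    {xs = x ∷ xs} _ paired | ()
      go (suc (suc m)) {k} {x ∷ xs}  _ paired | 2+m≡2+length-rest
        with go m (≡.sym (ℕ.suc-injective (ℕ.suc-injective 2+m≡2+length-rest))) (remove-pair paired (here refl))
      ... | n , m≡n+n , product-rest≈ =
        suc n , ≡.cong suc (≡.trans (≡.cong suc m≡n+n) (≡.sym (ℕ.+-suc n n))) , (begin
          product (x ∷ xs)                                ≈⟨ product-remove-pair paired (here refl) ⟩
          k ∙ product (remove (σ x) (remove x (x ∷ xs)))  ≈⟨ ∙-congˡ product-rest≈ ⟩
          k ∙ n × k                                       ∎)

module Field {c ℓ} (F : CommutativeRing c ℓ) (isField : IsField F)
             (_≟_ : Decidable (CommutativeRing._≈_ F)) where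

  open CommutativeRing F hiding (zero)
  open IsField isField
  open import Relation.Binary.Reasoning.Setoid setoid
  open import Algebra.Properties.Ring ring using (-1*x≈-x; -‿involutive; +-inverseˡ-unique; x∙y⁻¹≈ε⇒x≈y; -0#≈0#)
  open import Algebra.Properties.CommutativeSemigroup *-commutativeSemigroup using (x∙yz≈y∙xz)
  open import Algebra.Properties.CommutativeSemiring.Exp commutativeSemiring
    using (_^_; ^-homo-*; ^-assocʳ; ^-distrib-*; ^-congˡ)
  open import Algebra.Properties.Semiring.Mult semiring using (_×_; ×1-homo-*; ×-homo-+)

  infix 8 _⁻¹
  _⁻¹ : Carrier → Carrier
  x ⁻¹ with x ≟ 0#
  ... | yes _   = 0#
  ... | no x≉0 = proj₁ (inverse x x≉0)

  x*x⁻¹≈1 : ∀ {x} → ¬ x ≈ 0# → x * x ⁻¹ ≈ 1#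
  x*x⁻¹≈1 {x} x≉0 with x ≟ 0#
  ... | yes x≈0 = contradiction x≈0 x≉0
  ... | no x≉0′ = proj₂ (inverse x x≉0′)

  x≈0⇒x⁻¹≈0 : ∀ {x} → x ≈ 0# → x ⁻¹ ≈ 0#
  x≈0⇒x⁻¹≈0 {x} x≈0 with x ≟ 0#
  ... | yes _   = refl
  ... | no x≉0 = contradiction x≈0 x≉0

  x⁻¹*[x*y]≈y : ∀ {x} y → ¬ x ≈ 0# → x ⁻¹ * (x * y) ≈ y
  x⁻¹*[x*y]≈y {x} y x≉0 = begin
    x ⁻¹ * (x * y)   ≈⟨ x∙yz≈y∙xz (x ⁻¹) x y ⟩
    x * (x ⁻¹ * y)   ≈⟨ *-assoc x (x ⁻¹) y ⟨
    (x * x ⁻¹) * y   ≈⟨ *-congʳ (x*x⁻¹≈1 x≉0) ⟩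
    1# * y           ≈⟨ *-identityˡ y ⟩
    y                ∎

  *-cancelˡ : ∀ {x y z} → ¬ x ≈ 0# → x * y ≈ x * z → y ≈ z
  *-cancelˡ {x} {y} {z} x≉0 xy≈xz = begin
    y                ≈⟨ x⁻¹*[x*y]≈y y x≉0 ⟨
    x ⁻¹ * (x * y)   ≈⟨ *-congˡ xy≈xz ⟩
    x ⁻¹ * (x * z)   ≈⟨ x⁻¹*[x*y]≈y z x≉0 ⟩
    z                ∎

  x*y≈0⇒y≈0 : ∀ {x y} → ¬ x ≈ 0# → x * y ≈ 0# → y ≈ 0#
  x*y≈0⇒y≈0 x≉0 xy≈0 = *-cancelˡ x≉0 (trans xy≈0 (sym (zeroʳ _)))

  x^n≈0⇒x≈0 : ∀ {x} n → x ^ n ≈ 0# → x ≈ 0#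
  x^n≈0⇒x≈0 zero 1≈0 = contradiction (sym 1≈0) 0≉1
  x^n≈0⇒x≈0 {x} (suc n) x^[1+n]≈0 with x ≟ 0#
  ... | yes x≈0 = x≈0
  ... | no x≉0 = x^n≈0⇒x≈0 n (x*y≈0⇒y≈0 x≉0 x^[1+n]≈0)

  x*y≈1⇒y≈x⁻¹ : ∀ {x y} → x * y ≈ 1# → y ≈ x ⁻¹
  x*y≈1⇒y≈x⁻¹ {x} {y} xy≈1 = *-cancelˡ x≉0 (trans xy≈1 (sym (x*x⁻¹≈1 x≉0)))
    where
    x≉0 : ¬ x ≈ 0#
    x≉0 x≈0 = 0≉1 (trans (sym (zeroˡ y)) (trans (*-congʳ (sym x≈0)) xy≈1))

  ⁻¹-cong : ∀ {x y} → x ≈ y → x ⁻¹ ≈ y ⁻¹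
  ⁻¹-cong {x} {y} x≈y with x ≟ 0#
  ... | yes x≈0 = sym (x≈0⇒x⁻¹≈0 (trans (sym x≈y) x≈0))
  ... | no x≉0 = x*y≈1⇒y≈x⁻¹ (trans (*-congʳ (sym x≈y)) (proj₂ (inverse x x≉0)))

  infixl 7 _/_
  _/_ : Carrier → Carrier → Carrier
  x / y = x * y ⁻¹

  /-congʳ : ∀ {b x y} → x ≈ y → b / x ≈ b / y
  /-congʳ x≈y = *-congˡ (⁻¹-cong x≈y)

  x*[b/x]≈b : ∀ {x} b → ¬ x ≈ 0# → x * (b / x) ≈ b
  x*[b/x]≈b {x} b x≉0 = begin
    x * (b * x ⁻¹)   ≈⟨ x∙yz≈y∙xz x b (x ⁻¹) ⟩
    b * (x * x ⁻¹)   ≈⟨ *-congˡ (x*x⁻¹≈1 x≉0) ⟩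
    b * 1#           ≈⟨ *-identityʳ b ⟩
    b                ∎

  b/x≈x⇒x*x≈b : ∀ {b x} → ¬ x ≈ 0# → b / x ≈ x → x * x ≈ b
  b/x≈x⇒x*x≈b {b} x≉0 b/x≈x = trans (*-congˡ (sym b/x≈x)) (x*[b/x]≈b b x≉0)

  x*x≈b⇒b/x≈x : ∀ {b x} → ¬ x ≈ 0# → x * x ≈ b → b / x ≈ x
  x*x≈b⇒b/x≈x {b} x≉0 xx≈b = *-cancelˡ x≉0 (trans (x*[b/x]≈b b x≉0) (sym xx≈b))

  module _ {b} (b≉0 : ¬ b ≈ 0#) where

    b/x≉0 : ∀ {x} → ¬ x ≈ 0# → ¬ b / x ≈ 0#
    b/x≉0 {x} x≉0 b/x≈0 = b≉0 (trans (sym (x*[b/x]≈b b x≉0)) (trans (*-congˡ b/x≈0) (zeroʳ x)))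

    -- Thanks to the junk value 0 ⁻¹ = 0 this holds on the whole field, also at x = 0.
    b/[b/x]≈x : ∀ x → b / (b / x) ≈ x
    b/[b/x]≈x x = by-cases (x ≟ 0#)
      where
      by-cases : Dec (x ≈ 0#) → b / (b / x) ≈ x
      by-cases (yes x≈0) = trans (*-congˡ (x≈0⇒x⁻¹≈0 b/x≈0)) (trans (zeroʳ b) (sym x≈0))
        where
        b/x≈0 : b / x ≈ 0#
        b/x≈0 = trans (*-congˡ (x≈0⇒x⁻¹≈0 x≈0)) (zeroʳ b)
      by-cases (no x≉0)  = *-cancelˡ (b/x≉0 x≉0)
        (trans (x*[b/x]≈b b (b/x≉0 x≉0)) (sym (trans (*-comm _ _) (x*[b/x]≈b b x≉0))))

  -1≉1 : ¬ 1# + 1# ≈ 0# → ¬ - 1# ≈ 1#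
  -1≉1 2≉0 -1≈1 = 2≉0 (trans (+-congˡ (sym -1≈1)) (-‿inverseʳ 1#))

  -1≉0 : ¬ - 1# ≈ 0#
  -1≉0 -1≈0 = 0≉1 (sym (trans (sym (-‿involutive 1#)) (trans (-‿cong -1≈0) -0#≈0#)))

  x*x≈1⇒x≈-1 : ∀ {x} → x * x ≈ 1# → ¬ x ≈ 1# → x ≈ - 1#
  x*x≈1⇒x≈-1 {x} xx≈1 x≉1 = +-inverseˡ-unique x 1# (x*y≈0⇒y≈0 x-1≉0 [x-1][x+1]≈0)
    where
    x-1≉0 : ¬ x - 1# ≈ 0#
    x-1≉0 = x≉1 ∘ x∙y⁻¹≈ε⇒x≈y x 1#
    [x-1][x+1]≈0 : (x - 1#) * (x + 1#) ≈ 0#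
    [x-1][x+1]≈0 = begin
      (x - 1#) * (x + 1#)                 ≈⟨ distribˡ _ _ _ ⟩
      (x - 1#) * x + (x - 1#) * 1#        ≈⟨ +-cong (distribʳ _ _ _) (*-identityʳ _) ⟩
      (x * x + - 1# * x) + (x - 1#)       ≈⟨ +-congʳ (+-cong xx≈1 (-1*x≈-x x)) ⟩
      (1# - x) + (x - 1#)                 ≈⟨ +-assoc _ _ _ ⟩
      1# + (- x + (x - 1#))               ≈⟨ +-congˡ (+-assoc _ _ _) ⟨
      1# + ((- x + x) - 1#)               ≈⟨ +-congˡ (+-congʳ (-‿inverseˡ x)) ⟩
      1# + (0# - 1#)                      ≈⟨ +-congˡ (+-identityˡ _) ⟩
      1# - 1#                             ≈⟨ -‿inverseʳ 1# ⟩
      0#                                  ∎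

  1^n≈1 : ∀ n → 1# ^ n ≈ 1#
  1^n≈1 zero    = refl
  1^n≈1 (suc n) = trans (*-identityˡ _) (1^n≈1 n)

  pow≡^ : ∀ x n → pow F x n ≡ x ^ n
  pow≡^ x zero    = ≡.refl
  pow≡^ x (suc n) = ≡.cong (x *_) (pow≡^ x n)

  ×1-homo-^ : ∀ m n → (m ℕ.^ n) × 1# ≈ (m × 1#) ^ n
  ×1-homo-^ m zero    = +-identityʳ 1#
  ×1-homo-^ m (suc n) = trans (×1-homo-* m (m ℕ.^ n)) (*-congˡ (×1-homo-^ m n))

  odd×1≈0⇒1+1≉0 : ∀ u → suc (u ℕ.+ u) × 1# ≈ 0# → ¬ 1# + 1# ≈ 0#
  odd×1≈0⇒1+1≉0 u [1+2u]×1≈0 2≈0 = 0≉1 (begin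
    0#                          ≈⟨ [1+2u]×1≈0 ⟨
    1# + (u ℕ.+ u) × 1#         ≈⟨ +-congˡ (×-homo-+ 1# u u) ⟩
    1# + (u × 1# + u × 1#)      ≈⟨ +-congˡ (+-cong (*-identityʳ _) (*-identityʳ _)) ⟨
    1# + ((u × 1#) * 1# + (u × 1#) * 1#) ≈⟨ +-congˡ (distribˡ _ _ _) ⟨
    1# + (u × 1#) * (1# + 1#)   ≈⟨ +-congˡ (*-congˡ 2≈0) ⟩
    1# + (u × 1#) * 0#          ≈⟨ +-congˡ (zeroʳ _) ⟩
    1# + 0#                     ≈⟨ +-identityʳ 1# ⟩
    1#                          ∎)

  module _ {s u} (s≡1+2u : s ≡ suc (u ℕ.+ u)) (frobenius : ∀ x y → (x + y) ^ s ≈ x ^ s + y ^ s) where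

    a^[s+1]≈1⇒[a²+1]^[2u[u+1]]≈1 : ∀ {a} → a ^ (s ℕ.+ 1) ≈ 1# → ¬ a * a + 1# ≈ 0# →
                                    (a * a + 1#) ^ ((u ℕ.+ u) ℕ.* suc u) ≈ 1#
    a^[s+1]≈1⇒[a²+1]^[2u[u+1]]≈1 {a} a^[s+1]≈1 b≉0 = begin
      b ^ ((u ℕ.+ u) ℕ.* suc u)               ≈⟨ ^-assocʳ b (u ℕ.+ u) (suc u) ⟨
      (b ^ (u ℕ.+ u)) ^ suc u                 ≈⟨ *-identityʳ _ ⟨
      (b ^ (u ℕ.+ u)) ^ suc u * 1#            ≈⟨ *-congˡ [a²]^[1+u]≈1 ⟨
      (b ^ (u ℕ.+ u)) ^ suc u * (a * a) ^ suc u ≈⟨ ^-distrib-* _ _ (suc u) ⟨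
      (b ^ (u ℕ.+ u) * (a * a)) ^ suc u       ≈⟨ ^-congˡ (suc u) b^[2u]*a²≈1 ⟩
      1# ^ suc u                              ≈⟨ 1^n≈1 (suc u) ⟩
      1#                                      ∎
      where
      b : Carrier
      b = a * a + 1#

      [a²]^[1+u]≈1 : (a * a) ^ suc u ≈ 1#
      [a²]^[1+u]≈1 = begin
        (a * a) ^ suc u             ≈⟨ ^-distrib-* a a (suc u) ⟩
        a ^ suc u * a ^ suc u       ≈⟨ ^-homo-* a (suc u) (suc u) ⟨
        a ^ (suc u ℕ.+ suc u)       ≡⟨ ≡.cong (a ^_) ([1+2u]+1≡[1+u]+[1+u] u) ⟨
        a ^ (suc (u ℕ.+ u) ℕ.+ 1)   ≡⟨ ≡.cong (λ n → a ^ (n ℕ.+ 1)) s≡1+2u ⟨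
        a ^ (s ℕ.+ 1)               ≈⟨ a^[s+1]≈1 ⟩
        1#                          ∎

      [a²]^[s+1]≈1 : (a * a) ^ (s ℕ.+ 1) ≈ 1#
      [a²]^[s+1]≈1 = trans (^-distrib-* a a (s ℕ.+ 1)) (trans (*-cong a^[s+1]≈1 a^[s+1]≈1) (*-identityˡ 1#))

      b^s*a²≈b : b ^ s * (a * a) ≈ b
      b^s*a²≈b = begin
        b ^ s * (a * a)                          ≈⟨ *-congʳ (frobenius (a * a) 1#) ⟩
        ((a * a) ^ s + 1# ^ s) * (a * a)         ≈⟨ distribʳ _ _ _ ⟩
        (a * a) ^ s * (a * a) + 1# ^ s * (a * a) ≈⟨ +-cong (*-congˡ (sym (*-identityʳ _))) (*-congʳ (1^n≈1 s)) ⟩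
        (a * a) ^ s * (a * a) ^ 1 + 1# * (a * a) ≈⟨ +-cong (sym (^-homo-* (a * a) s 1)) (*-identityˡ _) ⟩
        (a * a) ^ (s ℕ.+ 1) + a * a              ≈⟨ +-congʳ [a²]^[s+1]≈1 ⟩
        1# + a * a                               ≈⟨ +-comm _ _ ⟩
        b                                        ∎

      b^[2u]*a²≈1 : b ^ (u ℕ.+ u) * (a * a) ≈ 1#
      b^[2u]*a²≈1 = *-cancelˡ b≉0 (begin
        b * (b ^ (u ℕ.+ u) * (a * a))  ≈⟨ *-assoc _ _ _ ⟨
        b ^ suc (u ℕ.+ u) * (a * a)     ≡⟨ ≡.cong (λ n → b ^ n * (a * a)) s≡1+2u ⟨
        b ^ s * (a * a)                 ≈⟨ b^s*a²≈b ⟩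
        b                               ≈⟨ *-identityʳ b ⟨
        b * 1#                          ∎)

module FiniteField {c ℓ} (F : CommutativeRing c ℓ) (isField : IsField F) {q} (order : HasOrder F q) where

  open CommutativeRing F hiding (zero)
  open IsField isField
  open import Relation.Binary.Reasoning.Setoid setoid
  open import Function.Properties.Inverse using (Inverse⇒Injection)
  open import Function.Construct.Symmetry using () renaming (inverse to inverse-sym)
  open import Function.Bundles using (Injection)
  open import Data.Fin.Properties using (inj⇒≟)
  open import Data.List using (tabulate)
  open import Data.List.Properties using (length-tabulate)
  open import Data.List.Membership.Setoid setoid using (_∈_; lose)
  open import Data.List.Membership.Setoid.Properties using (∈-tabulate⁺; ∈-resp-≈)
  open import Data.List.Relation.Unary.Unique.Setoid setoid using (Unique)
  open import Data.List.Relation.Unary.Unique.Setoid.Properties using (tabulate⁺)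
  open import Data.List.Relation.Unary.Any using (any?; satisfied)
  open import Algebra.Properties.Semiring.Mult semiring using (_×_)
  open import Algebra.Properties.CommutativeSemiring.Exp commutativeSemiring using (_^_)
  open import Algebra.Properties.Ring ring using (-1*x≈-x; -‿involutive)
  import Relation.Nullary.Decidable as Dec

  _≟_ : Decidable _≈_
  _≟_ = inj⇒≟ (Inverse⇒Injection (inverse-sym order))

  open Field F isField _≟_ public
  open Frobenius commutativeSemiring public using (frobenius-^)
  open ListProduct *-commutativeMonoid _≟_

  elements : List Carrier
  elements = tabulate (Inverse.to order)

  ∈-elements : ∀ x → x ∈ elements
  ∈-elements x = ∈-resp-≈ setoid (strictlyInverseˡ x) (∈-tabulate⁺ setoid (from x))
    where open Inverse order

  elements-unique : Unique elements
  elements-unique = tabulate⁺ setoid (Injection.injective (Inverse⇒Injection order))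

  square? : ∀ b → Dec (∃ λ x → x * x ≈ b)
  square? b = Dec.map′ satisfied (λ (x , xx≈b) → lose respects (∈-elements x) xx≈b)
                       (any? (λ x → (x * x) ≟ b) elements)
    where
    respects : ∀ {x y} → x ≈ y → x * x ≈ b → y * y ≈ b
    respects x≈y xx≈b = trans (*-cong (sym x≈y) (sym x≈y)) xx≈b

  characteristic : ∀ {p j} → q ≡ p ℕ.^ j → p × 1# ≈ 0#
  characteristic {p} {j} q≡p^j = x^n≈0⇒x≈0 j (begin
    (p × 1#) ^ j       ≈⟨ ×1-homo-^ p j ⟨
    (p ℕ.^ j) × 1#     ≡⟨ ≡.cong (_× 1#) q≡p^j ⟨
    q × 1#             ≈⟨ card×x≈ε +-abelianGroup order 1# ⟩
    0#                 ∎)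

  nonzero : List Carrier
  nonzero = remove 0# elements

  ∈-nonzero⁺ : ∀ {x} → ¬ x ≈ 0# → x ∈ nonzero
  ∈-nonzero⁺ x≉0 = ∈-remove⁺ (∈-elements _) (x≉0 ∘ sym)

  ∈-nonzero⁻ : ∀ {x} → x ∈ nonzero → ¬ x ≈ 0#
  ∈-nonzero⁻ x∈nonzero = proj₂ (∈-remove⁻ elements x∈nonzero) ∘ sym

  nonzero-unique : Unique nonzero
  nonzero-unique = remove-unique elements-unique

  length-nonzero : suc (length nonzero) ≡ q
  length-nonzero = ≡.trans (length-remove elements-unique (∈-elements 0#)) (length-tabulate _)

  module Division {b} (b≉0 : ¬ b ≈ 0#) where
    open Involution (b /_) /-congʳ (b/[b/x]≈x b≉0) public

    nonzero-closed : Closed nonzero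
    nonzero-closed x∈nonzero = ∈-nonzero⁺ (b/x≉0 b≉0 (∈-nonzero⁻ x∈nonzero))

  wilson : ¬ 1# + 1# ≈ 0# → product nonzero ≈ - 1#
  wilson 2≉0 = begin
    product nonzero                     ≈⟨ product-remove nonzero-unique (∈-nonzero⁺ 1≉0) ⟩
    1# * product (remove 1# nonzero)    ≈⟨ *-identityˡ _ ⟩
    product (remove 1# nonzero)         ≈⟨ product-remove (remove-unique nonzero-unique) -1∈ ⟩
    - 1# * product others               ≈⟨ *-congˡ product-others ⟩
    - 1# * 1#                           ≈⟨ *-identityʳ _ ⟩
    - 1#                                ∎
    where
    1≉0 : ¬ 1# ≈ 0#
    1≉0 = 0≉1 ∘ sym

    open Division 1≉0

    -1∈ : - 1# ∈ remove 1# nonzero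
    -1∈ = ∈-remove⁺ (∈-nonzero⁺ -1≉0) (-1≉1 2≉0 ∘ sym)

    others : List Carrier
    others = remove (- 1#) (remove 1# nonzero)

    others⊆nonzero : ∀ {y} → y ∈ others → y ∈ nonzero
    others⊆nonzero = proj₁ ∘ ∈-remove⁻ nonzero ∘ proj₁ ∘ ∈-remove⁻ (remove 1# nonzero)

    1/y≉y : ∀ {y} → y ∈ others → ¬ 1# / y ≈ y
    1/y≉y y∈ 1/y≈y with ∈-remove⁻ (remove 1# nonzero) y∈
    ... | y∈′ , -1≉y with ∈-remove⁻ nonzero y∈′
    ...   | y∈nonzero , 1≉y = -1≉y (sym (x*x≈1⇒x≈-1 (b/x≈x⇒x*x≈b (∈-nonzero⁻ y∈nonzero) 1/y≈y) (1≉y ∘ sym)))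

    others-paired : Paired 1# others
    others-paired = record
      { unique       = remove-unique (remove-unique nonzero-unique)
      ; closed       = remove-fixed-closed (x*x≈b⇒b/x≈x -1≉0 (trans (-1*x≈-x (- 1#)) (-‿involutive 1#)))
                         (remove-fixed-closed (x*x≈b⇒b/x≈x 1≉0 (*-identityˡ 1#)) nonzero-closed)
      ; fixpointFree = 1/y≉y
      ; pairsTo      = x*[b/x]≈b 1# ∘ ∈-nonzero⁻ ∘ others⊆nonzero
      }

    product-others : product others ≈ 1#
    product-others with product-paired others-paired
    ... | n , _ , product≈ = trans product≈ (1^n≈1 n)

  euler-criterion : ∀ {n b} → q ≡ suc (n ℕ.+ n) → ¬ 1# + 1# ≈ 0# → (¬ b ≈ 0# → b ^ n ≈ 1#) →
                    ∃ λ x → x * x ≈ b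
  euler-criterion {n} {b} q≡1+2n 2≉0 b^n≈1 with b ≟ 0# | square? b
  ... | yes b≈0 | _          = 0# , trans (zeroˡ 0#) (sym b≈0)
  ... | no _    | yes square = square
  ... | no b≉0  | no nonsquare with product-paired nonzero-paired
    where
    open Division b≉0
    nonzero-paired : Paired b nonzero
    nonzero-paired = record
      { unique       = nonzero-unique
      ; closed       = nonzero-closed
      ; fixpointFree = λ x∈ b/x≈x → nonsquare (_ , b/x≈x⇒x*x≈b (∈-nonzero⁻ x∈) b/x≈x)
      ; pairsTo      = λ x∈ → x*[b/x]≈b b (∈-nonzero⁻ x∈)
      }
  ... | m , length≡m+m , product≈ = contradiction (begin
    - 1#              ≈⟨ wilson 2≉0 ⟨
    product nonzero   ≈⟨ product≈ ⟩
    b ^ m             ≡⟨ ≡.cong (b ^_) m≡n ⟩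
    b ^ n             ≈⟨ b^n≈1 b≉0 ⟩
    1#                ∎) (-1≉1 2≉0)
    where
    m≡n : m ≡ n
    m≡n = m+m≡n+n⇒m≡n (ℕ.suc-injective (≡.trans (≡.cong suc (≡.sym length≡m+m))
                                                 (≡.trans length-nonzero q≡1+2n)))


open import Data.Nat using (ℕ; _+_; _*_; _^_; _%_; _≤_)
open import Data.Nat.Primality using (Prime)
open import Data.Product using (∃)
open import Relation.Binary.PropositionalEquality using (_≡_; _≢_)
open import Algebra.Bundles using (CommutativeRing)

lemma2p9 : ∀ {c ℓ} (F : CommutativeRing c ℓ) (p k : ℕ) → Prime p → p ≢ 2 → 1 ≤ k
           → IsField F → HasOrder F (p ^ (2 * k)) → (p ^ k) % 4 ≡ 1
           → (a : CommutativeRing.Carrier F)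
           → CommutativeRing._≈_ F (pow F a (p ^ k + 1)) (CommutativeRing.1# F)
           → ∃ λ x → CommutativeRing._≈_ F (CommutativeRing._*_ F x x)
                                         (CommutativeRing._+_ F (CommutativeRing._*_ F a a) (CommutativeRing.1# F))
lemma2p9 F p k p-prime _ _ isField order p^k%4≡1 a a^[p^k+1]≈1 =
  euler-criterion {n = N} q≡1+2N (odd×1≈0⇒1+1≉0 u [1+2u]×1≈0)
    (a^[s+1]≈1⇒[a²+1]^[2u[u+1]]≈1 {s} {u} s≡1+2u (frobenius-^ p-prime p×1≈0 k)
      (≡.subst (_≈ 1#) (pow≡^ a (s + 1)) a^[p^k+1]≈1))
  where
  open FiniteField F isField order
  open CommutativeRing F using (_≈_; 0#; 1#; semiring)
  open import Algebra.Properties.Semiring.Mult semiring using (_×_)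

  s u N : ℕ
  s = p ^ k
  u = s ℕ./ 4 * 2
  N = (u + u) * suc u

  s≡1+2u : s ≡ suc (u + u)
  s≡1+2u = m%4≡1⇒m≡1+2[2[m/4]] p^k%4≡1

  q≡s^2 : p ^ (2 * k) ≡ s ^ 2
  q≡s^2 = ≡.trans (≡.cong (p ^_) (ℕ.*-comm 2 k)) (≡.sym (ℕ.^-*-assoc p k 2))

  q≡1+2N : p ^ (2 * k) ≡ suc (N + N)
  q≡1+2N = ≡.trans q≡s^2 (≡.trans (≡.cong (_^ 2) s≡1+2u) ([1+2u]^2≡1+2[2u[1+u]] u))

  p×1≈0 : p × 1# ≈ 0#
  p×1≈0 = characteristic {p} {2 * k} ≡.refl

  [1+2u]×1≈0 : suc (u + u) × 1# ≈ 0#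
  [1+2u]×1≈0 = ≡.subst (λ n → n × 1# ≈ 0#) s≡1+2u (characteristic {s} {2} q≡s^2)
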